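{- Let $X$ be a connected, finite, simple $3$-valent plane graph such that the number of edges surrounding each face is divisible by $3$. Then $X$ has a coherent edge numbering, i.e., a map $\nu:E(X)\to\{1,2,3\}$ such that at each vertex $p$ the three edges incident to $p$ receive the numbers $1,2,3$ in this cyclic order with respect to the positive (counterclockwise) orientation around $p$. -}

module Defs where

open import Data.Nat using (ℕ; zero; suc; _+_; _≤_; _<_; _≤ᵇ_)
open import Data.Nat.Divisibility using (_∣_)
open import Data.Fin using (Fin; toℕ) renaming (zero to f0; suc to fs)
open import Data.List using (List; length; filterᵇ; upTo; allFin)
open import Data.Bool.ListAction using (all)
open import Data.Bool using (Bool; T)
open import Data.Product using (Σ; _×_; ∃)
open import Relation.Binary.PropositionalEquality using (_≡_; _≢_)
open import Relation.Nullary using (¬_)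

iter : ∀ {A : Set} → (A → A) → ℕ → A → A
iter f zero    x = x
iter f (suc k) x = f (iter f k x)

-- A 3-valent (cubic) oriented combinatorial map (rotation system) on n darts
-- (half-edges).  σ is the rotation of the darts around their vertex in the
-- positive (counterclockwise) direction; α is the edge involution exchanging
-- the two halves of an edge.  Vertices = σ-orbits, edges = α-orbits,
-- faces = orbits of φ = σ ∘ α.
record CubicMap : Set where
  field
    n     : ℕ
    σ     : Fin n → Fin n
    α     : Fin n → Fin n
    σ³    : ∀ d → σ (σ (σ d)) ≡ d
    σ-fix : ∀ d → σ d ≢ d
    α²    : ∀ d → α (α d) ≡ d
    α-fix : ∀ d → α d ≢ d

  φ : Fin n → Fin n
  φ d = σ (α d)

module _ (M : CubicMap) where
  open CubicMap M

  SameVertex : Fin n → Fin n → Set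
  SameVertex d d' = ∃ λ k → iter σ k d ≡ d'

  Loopless : Set
  Loopless = ∀ d → ¬ SameVertex d (α d)

  NoMultiEdges : Set
  NoMultiEdges = ∀ d d' → SameVertex d d' → SameVertex (α d) (α d') → d ≡ d'

  Simple : Set
  Simple = Loopless × NoMultiEdges

  data Reach : Fin n → Fin n → Set where
    here  : ∀ {d} → Reach d d
    viaσ  : ∀ {d e} → Reach (σ d) e → Reach d e
    viaα  : ∀ {d e} → Reach (α d) e → Reach d e

  Connected : Set
  Connected = ∀ d e → Reach d e

  -- number of orbits of a permutation f of Fin n: the number of darts that are
  -- the smallest element (w.r.t. toℕ) of their f-orbit
  isMinRep : (Fin n → Fin n) → Fin n → Bool
  isMinRep f d = all (λ k → toℕ d ≤ᵇ toℕ (iter f k d)) (upTo n)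

  numOrbits : (Fin n → Fin n) → ℕ
  numOrbits f = length (filterᵇ (isMinRep f) (allFin n))

  #V #E #F : ℕ
  #V = numOrbits σ
  #E = numOrbits α
  #F = numOrbits φ

  -- genus 0 (the map is a plane embedding): V - E + F = 2
  Planar : Set
  Planar = #V + #F ≡ #E + 2

  -- k is the length of the φ-orbit of d (= number of edges, counted along the
  -- boundary walk, of the face containing d)
  IsPeriod : (Fin n → Fin n) → Fin n → ℕ → Set
  IsPeriod f d k = 1 ≤ k × iter f k d ≡ d × (∀ j → 1 ≤ j → j < k → iter f j d ≢ d)

  FacesDiv3 : Set
  FacesDiv3 = ∀ d k → IsPeriod φ d k → 3 ∣ k

  -- cyclic successor on the labels {1,2,3}, encoded as Fin 3 = {0,1,2}
  next3 : Fin 3 → Fin 3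
  next3 f0           = fs f0
  next3 (fs f0)      = fs (fs f0)
  next3 (fs (fs f0)) = f0

  CoherentEdgeNumbering : Set
  CoherentEdgeNumbering =
    Σ (Fin n → Fin 3) λ ν → (∀ d → ν (α d) ≡ ν d) × (∀ d → ν (σ d) ≡ next3 (ν d))

module Submission where

-- A coherent numbering is a section of the 3-sheeted cover of the map whose darts are pairs
-- (d , c) with c : Fin 3, turning around a vertex raising the sheet and crossing an edge
-- keeping it. Shifting sheets is an automorphism of the cover, so if the sheets 0 and 1 over
-- one dart lie in different components, the component of the first one meets every fibre
-- exactly once and is such a section. Otherwise the cover is connected. It has 3E edges,
-- 3V vertices (σ has order 3) and at least 3F faces (each face length is divisible by 3, so
-- each face lifts to three faces). Euler's inequality V + F ≤ E + 2 for connected maps then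
-- gives 3 (V + F) ≤ 3 E + 2, contradicting V + F = E + 2.
--
-- Euler's inequality is proved by a spanning tree argument. Merging vertex classes along the
-- edges in some order uses V - 1 of them (the tree); merging face classes along the remaining
-- cotree edges joins all faces: the edges on the boundary of a proper union of faces are not
-- cotree edges, yet they contain a cycle, which cannot consist of tree edges only.

open import Defs
open import Data.Bool using (Bool; true; false; T; if_then_else_)
open import Data.Bool.Properties using (T-≡)
open import Data.Empty using (⊥; ⊥-elim)
open import Data.Fin using (Fin; toℕ; combine) renaming (zero to f0; suc to fs)
import Data.Fin.Properties as Fin
open import Data.List using (List; []; _∷_; _++_; length; filterᵇ; map; upTo; allFin; cartesianProduct)
open import Data.List.Extrema.Nat using (argmin; f[argmin]≤v⁺; argmin-all)
open import Data.List.Membership.Propositional using (_∈_)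
open import Data.List.Membership.Propositional.Properties using (∈-++⁻; ∈-upTo⁺; ∈-allFin; ∈-cartesianProduct⁺; ∈-filter⁺)
open import Data.List.Properties using (length-++; filter-++)
open import Data.List.Relation.Unary.All as All using (All; []; _∷_)
open import Data.List.Relation.Unary.All.Properties using (¬Any⇒All¬; all⁺; all⁻)
open import Data.List.Relation.Unary.Any as Any using (Any; here; there; any?)
open import Data.List.Relation.Unary.Unique.Propositional using (Unique; []; _∷_)
import Data.List.Relation.Unary.Unique.Propositional.Properties as Unique
open import Data.Nat using (ℕ; zero; suc; _+_; _*_; _∸_; _≤_; _<_; _%_; _/_; z≤n; s≤s; NonZero)
open import Data.Nat.DivMod using (m≡m%n+[m/n]*n; m%n<n)
open import Data.Nat.Divisibility using (_∣_; divides; ∣-trans; m%n≡0⇒n∣m)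
open import Data.Nat.Induction using (<-rec)
open import Data.Nat.Properties
open import Algebra.Properties.CommutativeSemigroup +-commutativeSemigroup using (xy∙z≈xz∙y)
open import Data.Product using (∃; _×_; _,_; proj₁; proj₂)
open import Data.Product.Properties using (≡-dec)
open import Data.Sum as Sum using (_⊎_; inj₁; inj₂)
open import Data.Unit using (⊤; tt)
open import Function using (_∘_; id; Equivalence)
open import Relation.Binary.Definitions using (DecidableEquality)
open import Relation.Binary.PropositionalEquality
open import Relation.Nullary
open import Relation.Nullary.Decidable using (dec-true; dec-false)
open import Relation.Unary using (Decidable)

module _ {A : Set} (f : A → A) where

  iter-+ : ∀ m n x → iter f (m + n) x ≡ iter f m (iter f n x)
  iter-+ zero    n x = refl
  iter-+ (suc m) n x = cong f (iter-+ m n x)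

  iter-sucʳ : ∀ k x → iter f (suc k) x ≡ iter f k (f x)
  iter-sucʳ zero    x = refl
  iter-sucʳ (suc k) x = cong f (iter-sucʳ k x)

  iter-preserves : (P : A → Set) → (∀ {x} → P x → P (f x)) → ∀ k {x} → P x → P (iter f k x)
  iter-preserves P pres zero    px = px
  iter-preserves P pres (suc k) px = pres (iter-preserves P pres k px)

  periodic⇒injective : ∀ k → (∀ x → iter f (suc k) x ≡ x) → ∀ {x y} → f x ≡ f y → x ≡ y
  periodic⇒injective k periodic {x} {y} eq = begin
    x                  ≡⟨ periodic x ⟨
    iter f (suc k) x   ≡⟨ iter-sucʳ k x ⟩
    iter f k (f x)     ≡⟨ cong (iter f k) eq ⟩
    iter f k (f y)     ≡⟨ iter-sucʳ k y ⟨
    iter f (suc k) y   ≡⟨ periodic y ⟩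
    y                  ∎
    where open ≡-Reasoning

  iter-injective : (∀ {x y} → f x ≡ f y → x ≡ y) → ∀ k {x y} → iter f k x ≡ iter f k y → x ≡ y
  iter-injective f-inj zero    eq = eq
  iter-injective f-inj (suc k) eq = iter-injective f-inj k (f-inj eq)

  iter-*-fixed : ∀ {p x} → iter f p x ≡ x → ∀ q → iter f (q * p) x ≡ x
  iter-*-fixed         fixed zero    = refl
  iter-*-fixed {p} {x} fixed (suc q) = begin
    iter f (p + q * p) x        ≡⟨ iter-+ p (q * p) x ⟩
    iter f p (iter f (q * p) x) ≡⟨ cong (iter f p) (iter-*-fixed fixed q) ⟩
    iter f p x                  ≡⟨ fixed ⟩
    x                           ∎
    where open ≡-Reasoning

  iter-% : ∀ {p x} .{{_ : NonZero p}} → iter f p x ≡ x → ∀ k → iter f k x ≡ iter f (k % p) x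
  iter-% {p} {x} fixed k = begin
    iter f k x                                ≡⟨ cong (λ j → iter f j x) (m≡m%n+[m/n]*n k p) ⟩
    iter f (k % p + (k / p) * p) x            ≡⟨ iter-+ (k % p) ((k / p) * p) x ⟩
    iter f (k % p) (iter f ((k / p) * p) x)   ≡⟨ cong (iter f (k % p)) (iter-*-fixed fixed (k / p)) ⟩
    iter f (k % p) x                          ∎
    where open ≡-Reasoning

module _ {A : Set} {M : ℕ} (ι : A → Fin M) (ι-injective : ∀ {x y} → ι x ≡ ι y → x ≡ y)
         (f : A → A) {P : A → Set} (f-preserves : ∀ {x} → P x → P (f x))
         (f-injective : ∀ {x y} → P x → P y → f x ≡ f y → x ≡ y) where

  private
    cancel : ∀ i t {x} → P x → iter f i x ≡ iter f (i + t) x → x ≡ iter f t x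
    cancel zero    t px eq = eq
    cancel (suc i) t px eq = cancel i t px
      (f-injective (iter-preserves f P f-preserves i px) (iter-preserves f P f-preserves (i + t) px) eq)

  return-time : ∀ {x} → P x → ∃ λ p → 1 ≤ p × p ≤ M × iter f p x ≡ x
  return-time {x} px
    with i , j , i<j , ιᵢ≡ιⱼ ← Fin.pigeonhole (n<1+n M) (λ k → ι (iter f (toℕ k) x))
    = toℕ j ∸ toℕ i
    , m<n⇒0<n∸m i<j
    , ≤-trans (m∸n≤m (toℕ j) (toℕ i)) (Fin.toℕ≤pred[n] j)
    , sym (cancel (toℕ i) (toℕ j ∸ toℕ i) px collision)
    where
    collision : iter f (toℕ i) x ≡ iter f (toℕ i + (toℕ j ∸ toℕ i)) x
    collision = trans (ι-injective ιᵢ≡ιⱼ) (cong (λ k → iter f k x) (sym (m+[n∸m]≡n (<⇒≤ i<j))))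

Least : (ℕ → Set) → ℕ → Set
Least P j = P j × (∀ i → i < j → ¬ P i)

least : {P : ℕ → Set} → Decidable P → ∀ k → P k → ∃ (Least P)
least {P} P? = <-rec (λ k → P k → ∃ (Least P)) step
  where
  step : ∀ k → (∀ {j} → j < k → P j → ∃ (Least P)) → P k → ∃ (Least P)
  step k below pk with anyUpTo? P? k
  ... | yes (j , j<k , pj) = below j<k pj
  ... | no  none           = k , pk , λ i i<k pi → none (i , i<k , pi)

does⇒ : {P : Set} (P? : Dec P) → does P? ≡ true → P
does⇒ (yes p) _ = p

count : {A : Set} → (A → Bool) → List A → ℕ
count p xs = length (filterᵇ p xs)

count-++ : {A : Set} (p : A → Bool) → ∀ xs ys → count p (xs ++ ys) ≡ count p xs + count p ys
count-++ p xs ys = trans (cong length (filter-++ _ xs ys)) (length-++ (filterᵇ p xs))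

module _ {A : Set} where

  count-cong : {p q : A → Bool} → (∀ x → p x ≡ q x) → ∀ xs → count p xs ≡ count q xs
  count-cong         p≗q [] = refl
  count-cong {p} {q} p≗q (x ∷ xs) with p x | q x | p≗q x
  ... | true  | true  | refl = cong suc (count-cong p≗q xs)
  ... | false | false | refl = count-cong p≗q xs

  count-mono : {p q : A → Bool} → (∀ x → p x ≡ true → q x ≡ true) → ∀ xs → count p xs ≤ count q xs
  count-mono         p⇒q [] = z≤n
  count-mono {p} {q} p⇒q (x ∷ xs) with p x | q x | p⇒q x
  ... | true  | true  | _ = s≤s (count-mono p⇒q xs)
  ... | false | true  | _ = m≤n⇒m≤1+n (count-mono p⇒q xs)
  ... | false | false | _ = count-mono p⇒q xs
  ... | true  | false | p⇒q′ with () ← p⇒q′ refl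

  module _ (_≟_ : DecidableEquality A) where

    occurrences : A → List A → ℕ
    occurrences w = count (λ y → does (y ≟ w))

    occurrences-absent : ∀ {w xs} → All (w ≢_) xs → occurrences w xs ≡ 0
    occurrences-absent [] = refl
    occurrences-absent {w} {y ∷ _} (w≢y ∷ w∉) rewrite dec-false (y ≟ w) (w≢y ∘ sym) = occurrences-absent w∉

    occurrences-unique : ∀ {w xs} → Unique xs → w ∈ xs → occurrences w xs ≡ 1
    occurrences-unique {w} (w∉ ∷ _) (here refl) rewrite dec-true (w ≟ w) refl =
      cong suc (occurrences-absent w∉)
    occurrences-unique {w} {y ∷ _} (y∉ ∷ u) (there w∈) rewrite dec-false (y ≟ w) (All.lookup y∉ w∈) =
      occurrences-unique u w∈

    count-switch-off : (p q : A → Bool) (w : A) → p w ≡ true → q w ≡ false →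
                       (∀ x → x ≢ w → q x ≡ p x) →
                       ∀ xs → count p xs ≡ count q xs + occurrences w xs
    count-switch-off p q w pw qw q≗p [] = refl
    count-switch-off p q w pw qw q≗p (x ∷ xs) with x ≟ w
    ... | yes refl rewrite pw | qw =
      trans (cong suc (count-switch-off p q w pw qw q≗p xs)) (sym (+-suc _ _))
    ... | no x≢w rewrite q≗p x x≢w with p x
    ... | true  = cong suc (count-switch-off p q w pw qw q≗p xs)
    ... | false = count-switch-off p q w pw qw q≗p xs

count-proj₁-row : {A B : Set} (q : A → Bool) (x : A) (b : Bool) → q x ≡ b → (ys : List B) →
                  count (q ∘ proj₁) (map (x ,_) ys) ≡ (if b then length ys else 0)
count-proj₁-row q x true  qx []       = refl
count-proj₁-row q x false qx []       = refl
count-proj₁-row q x true  qx (y ∷ ys) rewrite qx = cong suc (count-proj₁-row q x true qx ys)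
count-proj₁-row q x false qx (y ∷ ys) rewrite qx = count-proj₁-row q x false qx ys

count-proj₁ : {A B : Set} (q : A → Bool) → ∀ xs (ys : List B) →
              count (q ∘ proj₁) (cartesianProduct xs ys) ≡ count q xs * length ys
count-proj₁ q []       ys = refl
count-proj₁ q (x ∷ xs) ys with q x in qx
... | true  = trans (count-++ _ (map (x ,_) ys) _)
                    (cong₂ _+_ (count-proj₁-row q x true qx ys) (count-proj₁ q xs ys))
... | false = trans (count-++ _ (map (x ,_) ys) _)
                    (cong₂ _+_ (count-proj₁-row q x false qx ys) (count-proj₁ q xs ys))

split-at-last : {A : Set} {P : A → Set} → Decidable P → ∀ xs → Any P xs →
                ∃ λ pre → ∃ λ y → ∃ λ post → xs ≡ pre ++ y ∷ post × P y × All (¬_ ∘ P) post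
split-at-last P? (x ∷ xs) p∈x∷xs with any? P? xs
... | yes p∈xs = let pre , y , post , xs≡ , py , clean = split-at-last P? xs p∈xs
                 in x ∷ pre , y , post , cong (x ∷_) xs≡ , py , clean
split-at-last P? (x ∷ xs) (here px)    | no p∉xs = [] , x , xs , refl , px , ¬Any⇒All¬ xs p∉xs
split-at-last P? (x ∷ xs) (there p∈xs) | no p∉xs = ⊥-elim (p∉xs p∈xs)

module CubicEuler {A : Set} (_≟_ : DecidableEquality A)
  (darts : List A) (darts-complete : ∀ x → x ∈ darts) (darts-unique : Unique darts)
  {M : ℕ} (ι : A → Fin M) (ι-injective : ∀ {x y} → ι x ≡ ι y → x ≡ y)
  (s a : A → A) (s³ : ∀ x → s (s (s x)) ≡ x) (a² : ∀ x → a (a x) ≡ x) where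

  g : A → A
  g x = s (a x)

  s-injective : ∀ {x y} → s x ≡ s y → x ≡ y
  s-injective = periodic⇒injective s 2 s³

  a-injective : ∀ {x y} → a x ≡ a y → x ≡ y
  a-injective = periodic⇒injective a 1 a²

  data Conn : A → A → Set where
    conn-refl  : ∀ {x} → Conn x x
    conn-s     : ∀ {x} → Conn x (s x)
    conn-a     : ∀ {x} → Conn x (a x)
    conn-sym   : ∀ {x y} → Conn y x → Conn x y
    conn-trans : ∀ {x y z} → Conn x y → Conn y z → Conn x z

  Conn-invariant : {B : Set} (r : A → B) → (∀ x → r (s x) ≡ r x) → (∀ x → r (a x) ≡ r x) →
                   ∀ {x y} → Conn x y → r x ≡ r y
  Conn-invariant r r-s r-a conn-refl          = refl
  Conn-invariant r r-s r-a (conn-s {x})       = sym (r-s x)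
  Conn-invariant r r-s r-a (conn-a {x})       = sym (r-a x)
  Conn-invariant r r-s r-a (conn-sym c)       = sym (Conn-invariant r r-s r-a c)
  Conn-invariant r r-s r-a (conn-trans c c′)  = trans (Conn-invariant r r-s r-a c) (Conn-invariant r r-s r-a c′)

  -- A partition of A is encoded by an idempotent labelling r; its classes are counted by their
  -- representatives, the fixed points of r.
  Idempotent : (A → A) → Set
  Idempotent r = ∀ x → r (r x) ≡ r x

  isRep : (A → A) → A → Bool
  isRep r x = does (r x ≟ x)

  #classes : (A → A) → ℕ
  #classes r = count (isRep r) darts

  replace : A → A → A → A
  replace u w v = if does (v ≟ w) then u else v

  replace-hit : ∀ {u w v} → v ≡ w → replace u w v ≡ u
  replace-hit {u} {w} {v} v≡w rewrite dec-true (v ≟ w) v≡w = refl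

  replace-miss : ∀ {u w v} → v ≢ w → replace u w v ≡ v
  replace-miss {u} {w} {v} v≢w rewrite dec-false (v ≟ w) v≢w = refl

  replace-self : ∀ u w → replace u w u ≡ u
  replace-self u w with u ≟ w
  ... | yes _ = refl
  ... | no  _ = refl

  merge : (A → A) → A → A → A
  merge r e = replace (r e) (r (a e)) ∘ r

  merge-same : ∀ r e {x} → r x ≡ r (a e) → merge r e x ≡ r e
  merge-same r e = replace-hit

  merge-other : ∀ r e {x} → r x ≢ r (a e) → merge r e x ≡ r x
  merge-other r e = replace-miss

  merge-joins : ∀ r e → merge r e e ≡ merge r e (a e)
  merge-joins r e = trans (replace-self (r e) (r (a e))) (sym (merge-same r e {a e} refl))

  merge-idempotent : ∀ r e → Idempotent r → Idempotent (merge r e)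
  merge-idempotent r e r-idem x = by-cases (r x ≟ r (a e))
    where
    open ≡-Reasoning
    by-cases : Dec (r x ≡ r (a e)) → merge r e (merge r e x) ≡ merge r e x
    by-cases (yes same) = begin
      merge r e (merge r e x)       ≡⟨ cong (merge r e) (merge-same r e same) ⟩
      merge r e (r e)               ≡⟨ cong (replace (r e) (r (a e))) (r-idem e) ⟩
      replace (r e) (r (a e)) (r e) ≡⟨ replace-self (r e) (r (a e)) ⟩
      r e                           ≡⟨ merge-same r e same ⟨
      merge r e x                   ∎
    by-cases (no diff) = begin
      merge r e (merge r e x) ≡⟨ cong (merge r e) (merge-other r e diff) ⟩
      merge r e (r x)         ≡⟨ merge-other r e (subst (_≢ r (a e)) (sym (r-idem x)) diff) ⟩
      r (r x)                 ≡⟨ r-idem x ⟩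
      r x                     ≡⟨ merge-other r e diff ⟨
      merge r e x             ∎

  merge-trivial : ∀ r e → r e ≡ r (a e) → ∀ x → merge r e x ≡ r x
  merge-trivial r e joined x = by-cases (r x ≟ r (a e))
    where
    by-cases : Dec (r x ≡ r (a e)) → merge r e x ≡ r x
    by-cases (yes same) = trans (merge-same r e same) (trans joined (sym same))
    by-cases (no diff)  = merge-other r e diff

  merge-isRep : ∀ r e → Idempotent r → r e ≢ r (a e) → ∀ x → x ≢ r (a e) → isRep (merge r e) x ≡ isRep r x
  merge-isRep r e r-idem diff x x≢w = by-cases (r x ≟ r (a e))
    where
    by-cases : Dec (r x ≡ r (a e)) → isRep (merge r e) x ≡ isRep r x
    by-cases (yes same) = trans (dec-false (merge r e x ≟ x) merged≢x) (sym (dec-false (r x ≟ x) rx≢x))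
      where
      rx≢x : r x ≢ x
      rx≢x rx≡x = x≢w (trans (sym rx≡x) same)
      merged≢x : merge r e x ≢ x
      merged≢x merged≡x = diff (begin
        r e     ≡⟨ r-idem e ⟨
        r (r e) ≡⟨ cong r (trans (sym (merge-same r e same)) merged≡x) ⟩
        r x     ≡⟨ same ⟩
        r (a e) ∎)
        where open ≡-Reasoning
    by-cases (no other) = cong (λ z → does (z ≟ x)) (merge-other r e other)

  merge-#classes : ∀ r e → Idempotent r → r e ≢ r (a e) → #classes r ≡ suc (#classes (merge r e))
  merge-#classes r e r-idem diff = begin
    #classes r                                     ≡⟨ count-switch-off _≟_ _ _ w w-rep w-not-rep
                                                        (merge-isRep r e r-idem diff) darts ⟩
    #classes (merge r e) + occurrences _≟_ w darts ≡⟨ cong (#classes (merge r e) +_)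
                                                        (occurrences-unique _≟_ darts-unique (darts-complete w)) ⟩
    #classes (merge r e) + 1                       ≡⟨ +-comm _ 1 ⟩
    suc (#classes (merge r e))                     ∎
    where
    open ≡-Reasoning
    w = r (a e)
    w-rep : isRep r w ≡ true
    w-rep = dec-true (r w ≟ w) (r-idem (a e))
    w-not-rep : isRep (merge r e) w ≡ false
    w-not-rep = dec-false (merge r e w ≟ w) λ merged≡w → diff (trans (sym (merge-same r e (r-idem (a e)))) merged≡w)

  #classes-≤1 : ∀ r → (∀ x y → r x ≡ r y) → #classes r ≤ 1
  #classes-≤1 r constant = bound darts refl
    where
    bound : ∀ xs → xs ≡ darts → count (isRep r) xs ≤ 1
    bound []       _   = z≤n
    bound (y ∷ ys) ≡ds = ≤-trans (count-mono rep⇒ry (y ∷ ys)) (≤-reflexive (begin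
      occurrences _≟_ (r y) (y ∷ ys) ≡⟨ cong (occurrences _≟_ (r y)) ≡ds ⟩
      occurrences _≟_ (r y) darts    ≡⟨ occurrences-unique _≟_ darts-unique (darts-complete (r y)) ⟩
      1                              ∎))
      where
      open ≡-Reasoning
      rep⇒ry : ∀ x → isRep r x ≡ true → does (x ≟ r y) ≡ true
      rep⇒ry x x-rep = dec-true (x ≟ r y) (trans (sym (does⇒ (r x ≟ x) x-rep)) (constant x y))

  mergeAll : (A → A) → List A → A → A
  mergeAll r []       = r
  mergeAll r (e ∷ es) = mergeAll (merge r e) es

  unmerged : (A → A) → List A → List A
  unmerged r []       = []
  unmerged r (e ∷ es) with r e ≟ r (a e)
  ... | yes _ = e ∷ unmerged (merge r e) es
  ... | no  _ = unmerged (merge r e) es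

  mergeAll-respects : ∀ r L {x y} → r x ≡ r y → mergeAll r L x ≡ mergeAll r L y
  mergeAll-respects r []       eq = eq
  mergeAll-respects r (e ∷ es) eq = mergeAll-respects (merge r e) es (cong (replace (r e) (r (a e))) eq)

  mergeAll-joins : ∀ r L {e} → e ∈ L → mergeAll r L e ≡ mergeAll r L (a e)
  mergeAll-joins r (e ∷ es) (here refl) = mergeAll-respects (merge r e) es (merge-joins r e)
  mergeAll-joins r (_ ∷ es) (there e∈)  = mergeAll-joins _ es e∈

  mergeAll-idempotent : ∀ r L → Idempotent r → Idempotent (mergeAll r L)
  mergeAll-idempotent r []       r-idem = r-idem
  mergeAll-idempotent r (e ∷ es) r-idem = mergeAll-idempotent (merge r e) es (merge-idempotent r e r-idem)

  #classes-mergeAll : ∀ r L → Idempotent r →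
                      #classes r + length (unmerged r L) ≡ #classes (mergeAll r L) + length L
  #classes-mergeAll r []       r-idem = refl
  #classes-mergeAll r (e ∷ es) r-idem with r e ≟ r (a e)
  ... | yes joined = begin
    #classes r + suc (length U)            ≡⟨ +-suc (#classes r) (length U) ⟩
    suc (#classes r + length U)            ≡⟨ cong (λ c → suc (c + length U)) (count-cong same-reps darts) ⟩
    suc (#classes (merge r e) + length U)  ≡⟨ cong suc ih ⟩
    suc (#classes final + length es)       ≡⟨ +-suc _ (length es) ⟨
    #classes final + suc (length es)       ∎
    where
    open ≡-Reasoning
    U = unmerged (merge r e) es
    final = mergeAll (merge r e) es
    ih = #classes-mergeAll (merge r e) es (merge-idempotent r e r-idem)
    same-reps : ∀ x → isRep r x ≡ isRep (merge r e) x
    same-reps x = cong (λ z → does (z ≟ x)) (sym (merge-trivial r e joined x))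
  ... | no  diff   = begin
    #classes r + length U                  ≡⟨ cong (_+ length U) (merge-#classes r e r-idem diff) ⟩
    suc (#classes (merge r e) + length U)  ≡⟨ cong suc ih ⟩
    suc (#classes final + length es)       ≡⟨ +-suc _ (length es) ⟨
    #classes final + suc (length es)       ∎
    where
    open ≡-Reasoning
    U = unmerged (merge r e) es
    final = mergeAll (merge r e) es
    ih = #classes-mergeAll (merge r e) es (merge-idempotent r e r-idem)

  unmerged-∈ : ∀ r pre e post → mergeAll r pre e ≡ mergeAll r pre (a e) → e ∈ unmerged r (pre ++ e ∷ post)
  unmerged-∈ r [] e post joined with r e ≟ r (a e)
  ... | yes _    = here refl
  ... | no  diff = ⊥-elim (diff joined)
  unmerged-∈ r (x ∷ pre) e post joined with r x ≟ r (a x)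
  ... | yes _ = there (unmerged-∈ (merge r x) pre e post joined)
  ... | no  _ = unmerged-∈ (merge r x) pre e post joined

  EdgeCover : List A → Set
  EdgeCover L = ∀ x → x ∈ L ⊎ a x ∈ L

  module Euler (r₀ r₁ : A → A) (r₀-idem : Idempotent r₀) (r₁-idem : Idempotent r₁)
               (r₀-s : ∀ x → r₀ (s x) ≡ r₀ x) (r₁-g : ∀ x → r₁ (g x) ≡ r₁ x)
               (L : List A) (L-covers : EdgeCover L) (connected : ∀ x y → Conn x y) where

    component : A → A
    component = mergeAll r₀ L

    component-s : ∀ x → component (s x) ≡ component x
    component-s x = mergeAll-respects r₀ L (r₀-s x)

    component-a : ∀ x → component (a x) ≡ component x
    component-a x with L-covers x
    ... | inj₁ x∈L  = sym (mergeAll-joins r₀ L x∈L)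
    ... | inj₂ ax∈L = trans (mergeAll-joins r₀ L ax∈L) (cong component (a² x))

    component-constant : ∀ x y → component x ≡ component y
    component-constant x y = Conn-invariant component component-s component-a (connected x y)

    cotree : List A
    cotree = unmerged r₀ L

    dual : A → A
    dual = mergeAll r₁ cotree

    dual-g : ∀ x → dual (g x) ≡ dual x
    dual-g x = mergeAll-respects r₁ cotree (r₁-g x)

    dual-s : ∀ x → dual (s x) ≡ dual (a x)
    dual-s x = trans (cong (dual ∘ s) (sym (a² x))) (dual-g (a x))

    module Region (x₀ : A) where

      In : A → Set
      In y = dual y ≡ dual x₀

      In? : ∀ y → Dec (In y)
      In? y = dual y ≟ dual x₀

      Crossing : A → Set
      Crossing y = In y × ¬ In (a y)

      CrossingEdge : A → Set
      CrossingEdge e = Crossing e ⊎ Crossing (a e)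

      CrossingEdge? : ∀ e → Dec (CrossingEdge e)
      CrossingEdge? e = (In? e ×-dec ¬? (In? (a e))) ⊎-dec (In? (a e) ×-dec ¬? (In? (a (a e))))

      no-crossing⇒everything-in : (∀ y → ¬ Crossing y) → ∀ y → In y
      no-crossing⇒everything-in none y =
        does⇒ (In? y) (trans (sym (Conn-invariant inside inside-s inside-a (connected x₀ y))) (dec-true (In? x₀) refl))
        where
        inside : A → Bool
        inside y = does (In? y)
        inside-a : ∀ y → inside (a y) ≡ inside y
        inside-a y with In? y | In? (a y)
        ... | yes _  | yes _   = refl
        ... | no  _  | no  _   = refl
        ... | yes y-in  | no ay-out = ⊥-elim (none y (y-in , ay-out))
        ... | no y-out  | yes ay-in = ⊥-elim (none (a y) (ay-in , y-out ∘ subst In (a² y)))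
        inside-s : ∀ y → inside (s y) ≡ inside y
        inside-s y = trans (cong (λ z → does (z ≟ dual x₀)) (dual-s y)) (inside-a y)

      crossing-not-cotree : ∀ {e} → CrossingEdge e → e ∈ cotree → ⊥
      crossing-not-cotree (inj₁ (e-in , ae-out))  e∈ = ae-out (trans (sym (mergeAll-joins r₁ cotree e∈)) e-in)
      crossing-not-cotree (inj₂ (ae-in , aae-out)) e∈ =
        aae-out (trans (cong dual (a² _)) (trans (mergeAll-joins r₁ cotree e∈) ae-in))

      -- The next crossing dart along the boundary of the region: turn around the vertex of a y
      -- until the edge leaves the region again.
      turn : A → A
      turn y with In? (a (s (a y)))
      ... | yes _ = s (s (a y))
      ... | no  _ = s (a y)

      turn-crossing : ∀ {y} → Crossing y → Crossing (turn y)
      turn-crossing {y} (y-in , ay-out) with In? (a (s (a y)))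
      ... | yes asay-in = trans (dual-s (s (a y))) asay-in ,
                          λ out → ay-out (trans (cong dual (sym (s³ (a y)))) (trans (dual-s (s (s (a y)))) out))
      ... | no  asay-out = trans (dual-g y) y-in , asay-out

      turn-vertex : (r : A → A) → (∀ x → r (s x) ≡ r x) → ∀ y → r (turn y) ≡ r (a y)
      turn-vertex r r-s y with In? (a (s (a y)))
      ... | yes _ = trans (r-s (s (a y))) (r-s (a y))
      ... | no  _ = r-s (a y)

      turn-injective : ∀ {y z} → Crossing y → Crossing z → turn y ≡ turn z → y ≡ z
      turn-injective {y} {z} (y-in , ay-out) (z-in , az-out) eq with In? (a (s (a y))) | In? (a (s (a z)))
      ... | yes _ | yes _ = a-injective (s-injective (s-injective eq))
      ... | no  _ | no  _ = a-injective (s-injective eq)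
      ... | no  _ | yes _ = ⊥-elim (ay-out (subst In (sym (s-injective eq)) (trans (dual-g z) z-in)))
      ... | yes _ | no  _ = ⊥-elim (az-out (subst In (s-injective eq) (trans (dual-g y) y-in)))

      -- The crossing darts form turn-cycles, and every edge of such a cycle except the last
      -- one in L has already been merged into the forest when that last edge e is reached.
      -- So the ends of e are already joined, and e would have been a cotree edge.
      module LastCrossing {pre e post} (L≡ : L ≡ pre ++ e ∷ post) (post-clean : All (¬_ ∘ CrossingEdge) post)
                          (x : A) (x-crossing : Crossing x) (x-on-e : x ≡ e ⊎ x ≡ a e) where

        forest : A → A
        forest = mergeAll r₀ pre

        forest-s : ∀ y → forest (s y) ≡ forest y
        forest-s y = mergeAll-respects r₀ pre (r₀-s y)

        Joined : A → Set
        Joined z = forest z ≡ forest (a z)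

        joined-flip : ∀ {z} → Joined (a z) → Joined z
        joined-flip {z} joined = sym (trans joined (cong forest (a² z)))

        e-crossing : CrossingEdge e
        e-crossing = Sum.map (λ x≡e → subst Crossing x≡e x-crossing)
                             (λ x≡ae → subst Crossing x≡ae x-crossing) x-on-e

        e-separates : ¬ Joined e
        e-separates joined =
          crossing-not-cotree e-crossing
            (subst (λ l → e ∈ unmerged r₀ l) (sym L≡) (unmerged-∈ r₀ pre e post joined))

        x-separates : ¬ Joined x
        x-separates = Sum.[ (λ x≡e → e-separates ∘ subst Joined x≡e)
                          , (λ x≡ae → e-separates ∘ joined-flip ∘ subst Joined x≡ae) ]′ x-on-e

        off-e : ∀ {y} → Crossing y → y ≢ x → y ≢ e × a y ≢ e
        off-e {y} (_ , ay-out) y≢x = by-cases x-on-e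
          where
          by-cases : x ≡ e ⊎ x ≡ a e → y ≢ e × a y ≢ e
          by-cases (inj₁ x≡e)  = (λ y≡e → y≢x (trans y≡e (sym x≡e)))
                               , (λ ay≡e → ay-out (subst In (trans x≡e (sym ay≡e)) (proj₁ x-crossing)))
          by-cases (inj₂ x≡ae) = (λ y≡e → ay-out (subst In (trans x≡ae (cong a (sym y≡e))) (proj₁ x-crossing)))
                               , (λ ay≡e → y≢x (trans (sym (a² y)) (trans (cong a ay≡e) (sym x≡ae))))

        listed-earlier : ∀ {z} → z ∈ L → CrossingEdge z → z ≢ e → Joined z
        listed-earlier {z} z∈L z-crossing z≢e with ∈-++⁻ pre (subst (z ∈_) L≡ z∈L)
        ... | inj₁ z∈pre          = mergeAll-joins r₀ pre z∈pre
        ... | inj₂ (here z≡e)     = ⊥-elim (z≢e z≡e)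
        ... | inj₂ (there z∈post) = ⊥-elim (All.lookup post-clean z∈post z-crossing)

        other-crossing-joined : ∀ {y} → Crossing y → y ≢ x → Joined y
        other-crossing-joined {y} y-crossing y≢x with L-covers y
        ... | inj₁ y∈L  = listed-earlier y∈L (inj₁ y-crossing) (proj₁ (off-e y-crossing y≢x))
        ... | inj₂ ay∈L = joined-flip
          (listed-earlier ay∈L (inj₂ (subst Crossing (sym (a² y)) y-crossing)) (proj₂ (off-e y-crossing y≢x)))

        turn-orbit : ∀ j → forest (iter turn (suc j) x) ≡ forest (a x)
        turn-orbit zero    = turn-vertex forest forest-s x
        turn-orbit (suc j) = begin
          forest (turn y) ≡⟨ turn-vertex forest forest-s y ⟩
          forest (a y)    ≡⟨ other-crossing-joined y-crossing y≢x ⟨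
          forest y        ≡⟨ turn-orbit j ⟩
          forest (a x)    ∎
          where
          open ≡-Reasoning
          y = iter turn (suc j) x
          y-crossing = iter-preserves turn Crossing turn-crossing (suc j) x-crossing
          y≢x : y ≢ x
          y≢x y≡x = x-separates (trans (cong forest (sym y≡x)) (turn-orbit j))

        absurd : ⊥
        absurd with return-time ι ι-injective turn turn-crossing turn-injective x-crossing
        ... | suc m , _ , _ , back = x-separates (trans (cong forest (sym back)) (turn-orbit m))

      crossing-listed : ∀ {y} → Crossing y → Any CrossingEdge L
      crossing-listed {y} y-crossing with L-covers y
      ... | inj₁ y∈L  = Any.map (λ { refl → inj₁ y-crossing }) y∈L
      ... | inj₂ ay∈L = Any.map (λ { refl → inj₂ (subst Crossing (sym (a² y)) y-crossing) }) ay∈L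

      no-crossing : ∀ y → ¬ Crossing y
      no-crossing y y-crossing with split-at-last CrossingEdge? L (crossing-listed y-crossing)
      ... | _ , e , _ , L≡ , inj₁ e-crossing  , clean = LastCrossing.absurd L≡ clean e e-crossing (inj₁ refl)
      ... | _ , e , _ , L≡ , inj₂ ae-crossing , clean = LastCrossing.absurd L≡ clean (a e) ae-crossing (inj₂ refl)

    dual-constant : ∀ x y → dual x ≡ dual y
    dual-constant x y = sym (Region.no-crossing⇒everything-in x (Region.no-crossing x) y)

    euler : #classes r₀ + #classes r₁ ≤ length L + 2
    euler = +-cancelʳ-≤ C _ _ (begin
      (#classes r₀ + #classes r₁) + C                 ≡⟨ xy∙z≈xz∙y (#classes r₀) (#classes r₁) C ⟩
      (#classes r₀ + C) + #classes r₁                 ≤⟨ +-monoʳ-≤ (#classes r₀ + C) (m≤m+n (#classes r₁) _) ⟩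
      (#classes r₀ + C) + (#classes r₁ + length (unmerged r₁ cotree))
        ≡⟨ cong₂ _+_ (#classes-mergeAll r₀ L r₀-idem) (#classes-mergeAll r₁ cotree r₁-idem) ⟩
      (#classes component + length L) + (#classes dual + C)
        ≤⟨ +-mono-≤ (+-monoˡ-≤ (length L) (#classes-≤1 component component-constant))
                    (+-monoˡ-≤ C (#classes-≤1 dual dual-constant)) ⟩
      (1 + length L) + (1 + C)                        ≡⟨ cong suc (+-suc (length L) C) ⟩
      2 + (length L + C)                              ≡⟨ cong (_+ C) (+-comm 2 (length L)) ⟩
      (length L + 2) + C                              ∎)
      where
      open ≤-Reasoning
      C = length cotree

module _ (X : CubicMap) where
  open CubicMap X

  period-divides : ∀ {f d p k} → IsPeriod X f d p → iter f k d ≡ d → p ∣ k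
  period-divides {f} {d} {suc p} {k} (_ , fixed , minimal) returns =
    m%n≡0⇒n∣m k (suc p) (by-cases (k % suc p) refl)
    where
    by-cases : ∀ r → k % suc p ≡ r → r ≡ 0
    by-cases zero    _  = refl
    by-cases (suc r) eq = ⊥-elim (minimal (suc r) (s≤s z≤n) (subst (_< suc p) eq (m%n<n k (suc p)))
      (trans (cong (λ j → iter f j d) (sym eq)) (trans (sym (iter-% f fixed k)) returns)))

  minimal-period : ∀ f {d p} → 1 ≤ p → iter f p d ≡ d → ∃ (IsPeriod X f d)
  minimal-period f {d} 1≤p returns
    with j , (1≤j , fixed) , below ← least (λ j → (1 ≤? j) ×-dec (iter f j d Fin.≟ d)) _ (1≤p , returns)
    = j , 1≤j , fixed , λ i 1≤i i<j fixedᵢ → below i i<j (1≤i , fixedᵢ)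

  σ-injective : ∀ {d e} → σ d ≡ σ e → d ≡ e
  σ-injective = periodic⇒injective σ 2 σ³

  α-injective : ∀ {d e} → α d ≡ α e → d ≡ e
  α-injective = periodic⇒injective α 1 α²

  φ-injective : ∀ {d e} → φ d ≡ φ e → d ≡ e
  φ-injective = α-injective ∘ σ-injective

  σ-period : ∀ d → IsPeriod X σ d 3
  σ-period d = s≤s z≤n , σ³ d , not-earlier
    where
    not-earlier : ∀ i → 1 ≤ i → i < 3 → iter σ i d ≢ d
    not-earlier 1 _ _ = σ-fix d
    not-earlier 2 _ _ = λ σσd≡d → σ-fix d (sym (trans (sym (σ³ d)) (cong σ σσd≡d)))
    not-earlier (suc (suc (suc _))) _ (s≤s (s≤s (s≤s ())))

  σ-returns : ∀ {d k} → iter σ k d ≡ d → 3 ∣ k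
  σ-returns {d} = period-divides (σ-period d)

  permutation-returns : ∀ f → (∀ {d e} → f d ≡ f e → d ≡ e) → ∀ d → ∃ λ p → 1 ≤ p × p ≤ n × iter f p d ≡ d
  permutation-returns f f-injective d = return-time id id f {P = λ _ → ⊤} _ (λ _ _ → f-injective) {d} tt

  φ-returns : FacesDiv3 X → ∀ {d k} → iter φ k d ≡ d → 3 ∣ k
  φ-returns faces-div3 {d} returns
    with p , 1≤p , _ , returnsₚ ← permutation-returns φ φ-injective d
    with j , period ← minimal-period φ 1≤p returnsₚ
    = ∣-trans (faces-div3 d j period) (period-divides period returns)

  rot : Fin 3 → Fin 3
  rot = next3 X

  rot³ : ∀ c → rot (rot (rot c)) ≡ c
  rot³ f0           = refl
  rot³ (fs f0)      = refl
  rot³ (fs (fs f0)) = refl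

  rot-returns : ∀ {t} → 3 ∣ t → ∀ c → iter rot t c ≡ c
  rot-returns (divides q refl) c = iter-*-fixed rot (rot³ c) q

  rot-other : ∀ {c c′} → c ≢ c′ → c′ ≡ rot c ⊎ c′ ≡ rot (rot c)
  rot-other {f0}           {f0}           c≢c′ = ⊥-elim (c≢c′ refl)
  rot-other {f0}           {fs f0}        _    = inj₁ refl
  rot-other {f0}           {fs (fs f0)}   _    = inj₂ refl
  rot-other {fs f0}        {f0}           _    = inj₂ refl
  rot-other {fs f0}        {fs f0}        c≢c′ = ⊥-elim (c≢c′ refl)
  rot-other {fs f0}        {fs (fs f0)}   _    = inj₁ refl
  rot-other {fs (fs f0)}   {f0}           _    = inj₁ refl
  rot-other {fs (fs f0)}   {fs f0}        _    = inj₂ refl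
  rot-other {fs (fs f0)}   {fs (fs f0)}   c≢c′ = ⊥-elim (c≢c′ refl)

  Dart₃ : Set
  Dart₃ = Fin n × Fin 3

  lift : (Fin n → Fin n) → Dart₃ → Dart₃
  lift f (d , c) = f d , rot c

  σ₃ α₃ : Dart₃ → Dart₃
  σ₃ = lift σ
  α₃ (d , c) = α d , c

  _≟₃_ : DecidableEquality Dart₃
  _≟₃_ = ≡-dec Fin._≟_ Fin._≟_

  darts₃ : List Dart₃
  darts₃ = cartesianProduct (allFin n) (allFin 3)

  σ₃³ : ∀ x → σ₃ (σ₃ (σ₃ x)) ≡ x
  σ₃³ (d , c) = cong₂ _,_ (σ³ d) (rot³ c)

  α₃² : ∀ x → α₃ (α₃ x) ≡ x
  α₃² (d , c) = cong (_, c) (α² d)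

  ι₃ : Dart₃ → Fin (n * 3)
  ι₃ (d , c) = combine d c

  ι₃-injective : ∀ {x y} → ι₃ x ≡ ι₃ y → x ≡ y
  ι₃-injective {d , c} {d′ , c′} eq with refl , refl ← Fin.combine-injective d c d′ c′ eq = refl

  darts₃-complete : ∀ x → x ∈ darts₃
  darts₃-complete (d , c) = ∈-cartesianProduct⁺ (∈-allFin d) (∈-allFin c)

  darts₃-unique : Unique darts₃
  darts₃-unique = Unique.cartesianProduct⁺ (Unique.allFin⁺ n) (Unique.allFin⁺ 3)

  open CubicEuler _≟₃_ darts₃ darts₃-complete darts₃-unique ι₃ ι₃-injective σ₃ α₃ σ₃³ α₃²

  module OrbitLabel (f : Fin n → Fin n) (f-injective : ∀ {d e} → f d ≡ f e → d ≡ e)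
                    (f-returns : ∀ {d k} → iter f k d ≡ d → 3 ∣ k) where

    exponent : Fin n → ℕ
    exponent d = argmin (λ k → toℕ (iter f k d)) 0 (upTo n)

    orbit-min : Fin n → Fin n
    orbit-min d = iter f (exponent d) d

    orbit-min-≤ : ∀ d k → toℕ (orbit-min d) ≤ toℕ (iter f k d)
    orbit-min-≤ d k with permutation-returns f f-injective d
    ... | suc p , _ , p≤n , returns =
      subst (λ e → toℕ (orbit-min d) ≤ toℕ e) (sym (iter-% f returns k))
        (f[argmin]≤v⁺ {f = λ j → toℕ (iter f j d)} 0 (upTo n) (inj₂ (Any.map (λ { refl → ≤-refl }) reduced∈)))
      where
      reduced∈ : k % suc p ∈ upTo n
      reduced∈ = ∈-upTo⁺ (≤-trans (m%n<n k (suc p)) p≤n)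

    orbit-min-least : ∀ d k {e} → iter f k d ≡ e → toℕ (orbit-min d) ≤ toℕ e
    orbit-min-least d k refl = orbit-min-≤ d k

    orbit-min-f : ∀ d → orbit-min (f d) ≡ orbit-min d
    orbit-min-f d with permutation-returns f f-injective d
    ... | suc p , _ , _ , returns = Fin.toℕ-injective (≤-antisym
      (orbit-min-least (f d) (exponent d + p) (begin
        iter f (exponent d + p) (f d)        ≡⟨ iter-+ f (exponent d) p (f d) ⟩
        iter f (exponent d) (iter f p (f d)) ≡⟨ cong (iter f (exponent d)) (trans (sym (iter-sucʳ f p d)) returns) ⟩
        orbit-min d                          ∎))
      (orbit-min-least d (suc (exponent (f d))) (iter-sucʳ f (exponent (f d)) d)))
      where open ≡-Reasoning

    orbit-min-iter : ∀ k d → orbit-min (iter f k d) ≡ orbit-min d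
    orbit-min-iter zero    d = refl
    orbit-min-iter (suc k) d = trans (orbit-min-f (iter f k d)) (orbit-min-iter k d)

    orbit-min-isMinRep : ∀ d → T (isMinRep X f d) → orbit-min d ≡ d
    orbit-min-isMinRep d minimal = Fin.toℕ-injective (≤-antisym (orbit-min-≤ d 0)
      (argmin-all (λ k → toℕ (iter f k d)) {P = λ k → toℕ d ≤ toℕ (iter f k d)} ≤-refl
        (All.map (≤ᵇ⇒≤ _ _) (all⁺ _ (upTo n) minimal))))

    rot-agrees-≤ : ∀ d {i j} → i ≤ j → iter f i d ≡ iter f j d → ∀ c → iter rot i c ≡ iter rot j c
    rot-agrees-≤ d {i} i≤j eq c with t , refl ← m≤n⇒∃[o]m+o≡n i≤j = begin
      iter rot i c               ≡⟨ cong (iter rot i) (rot-returns (f-returns {k = t} t-returns) c) ⟨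
      iter rot i (iter rot t c)  ≡⟨ iter-+ rot i t c ⟨
      iter rot (i + t) c         ∎
      where
      open ≡-Reasoning
      t-returns : iter f t d ≡ d
      t-returns = sym (iter-injective f f-injective i (trans eq (iter-+ f i t d)))

    rot-agrees : ∀ d {i j} → iter f i d ≡ iter f j d → ∀ c → iter rot i c ≡ iter rot j c
    rot-agrees d {i} {j} eq c with ≤-total i j
    ... | inj₁ i≤j = rot-agrees-≤ d i≤j eq c
    ... | inj₂ j≤i = sym (rot-agrees-≤ d j≤i (sym eq) c)

    -- label x is the point of the lifted orbit of x lying over the minimum of the orbit of
    -- proj₁ x. As every return time of f is a multiple of 3, the lifted orbit meets that fibre
    -- only once, so label is constant on lifted orbits.
    label : Dart₃ → Dart₃
    label (d , c) = orbit-min d , iter rot (exponent d) c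

    label-lift : ∀ x → label (lift f x) ≡ label x
    label-lift (d , c) = cong₂ _,_ (orbit-min-f d) (begin
      iter rot (exponent (f d)) (rot c) ≡⟨ iter-sucʳ rot (exponent (f d)) c ⟨
      iter rot (suc (exponent (f d))) c ≡⟨ rot-agrees d {suc (exponent (f d))} {exponent d} same-end c ⟩
      iter rot (exponent d) c           ∎)
      where
      open ≡-Reasoning
      same-end : iter f (suc (exponent (f d))) d ≡ iter f (exponent d) d
      same-end = trans (iter-sucʳ f (exponent (f d)) d) (orbit-min-f d)

    label-idempotent : ∀ x → label (label x) ≡ label x
    label-idempotent (d , c) = cong₂ _,_ min-min (rot-agrees (orbit-min d) {exponent (orbit-min d)} {0} min-min _)
      where
      min-min : orbit-min (orbit-min d) ≡ orbit-min d
      min-min = orbit-min-iter (exponent d) d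

    label-isMinRep : ∀ d → T (isMinRep X f d) → ∀ c → label (d , c) ≡ (d , c)
    label-isMinRep d minimal c = cong₂ _,_ fixed (rot-agrees d {exponent d} {0} fixed c)
      where
      fixed : orbit-min d ≡ d
      fixed = orbit-min-isMinRep d minimal

    #orbits-≤-#classes : numOrbits X f * 3 ≤ #classes label
    #orbits-≤-#classes = begin
      numOrbits X f * 3                   ≡⟨ count-proj₁ (isMinRep X f) (allFin n) (allFin 3) ⟨
      count (isMinRep X f ∘ proj₁) darts₃ ≤⟨ count-mono fixed darts₃ ⟩
      #classes label                      ∎
      where
      open ≤-Reasoning
      fixed : ∀ x → isMinRep X f (proj₁ x) ≡ true → isRep label x ≡ true
      fixed (d , c) minimal = dec-true (label (d , c) ≟₃ (d , c)) (label-isMinRep d (Equivalence.from T-≡ minimal) c)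

  shift : Dart₃ → Dart₃
  shift (d , c) = d , rot c

  Conn-shift : ∀ {x y} → Conn x y → Conn (shift x) (shift y)
  Conn-shift conn-refl          = conn-refl
  Conn-shift conn-s             = conn-s
  Conn-shift conn-a             = conn-a
  Conn-shift (conn-sym p)       = conn-sym (Conn-shift p)
  Conn-shift (conn-trans p q)   = conn-trans (Conn-shift p) (Conn-shift q)

  Reach-lift : ∀ {d e} → Reach X d e → ∀ c′ → ∃ λ c → Conn (d , c) (e , c′)
  Reach-lift here       c′ = c′ , conn-refl
  Reach-lift {d} (viaσ r) c′ with c , path ← Reach-lift r c′ =
    rot (rot c) , conn-trans (subst (λ z → Conn (d , rot (rot c)) (σ d , z)) (rot³ c) conn-s) path
  Reach-lift (viaα r) c′ with c , path ← Reach-lift r c′ = c , conn-trans conn-a path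

  iter-α : ∀ k d → iter α k d ≡ d ⊎ iter α k d ≡ α d
  iter-α zero    d = inj₁ refl
  iter-α (suc k) d with iter-α k d
  ... | inj₁ eq = inj₂ (cong α eq)
  ... | inj₂ eq = inj₁ (trans (cong α eq) (α² d))

  isMinRep-α : ∀ d → toℕ d ≤ toℕ (α d) → T (isMinRep X α d)
  isMinRep-α d d≤αd = all⁻ _ (All.universal (λ k → ≤⇒≤ᵇ (bound k)) (upTo n))
    where
    bound : ∀ k → toℕ d ≤ toℕ (iter α k d)
    bound k with iter-α k d
    ... | inj₁ eq = ≤-reflexive (cong toℕ (sym eq))
    ... | inj₂ eq = subst (λ e → toℕ d ≤ toℕ e) (sym eq) d≤αd

  edge-rep : ∀ d → T (isMinRep X α d) ⊎ T (isMinRep X α (α d))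
  edge-rep d with ≤-total (toℕ d) (toℕ (α d))
  ... | inj₁ d≤αd = inj₁ (isMinRep-α d d≤αd)
  ... | inj₂ αd≤d = inj₂ (isMinRep-α (α d) (subst (λ e → toℕ (α d) ≤ toℕ e) (sym (α² d)) αd≤d))

  edges₃ : List Dart₃
  edges₃ = filterᵇ (isMinRep X α ∘ proj₁) darts₃

  edges₃-cover : EdgeCover edges₃
  edges₃-cover x@(d , _) with edge-rep d
  ... | inj₁ d-rep  = inj₁ (∈-filter⁺ (T? ∘ isMinRep X α ∘ proj₁) (darts₃-complete x) d-rep)
  ... | inj₂ αd-rep = inj₂ (∈-filter⁺ (T? ∘ isMinRep X α ∘ proj₁) (darts₃-complete (α₃ x)) αd-rep)

  length-edges₃ : length edges₃ ≡ #E X * 3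
  length-edges₃ = count-proj₁ (isMinRep X α) (allFin n) (allFin 3)

  module _ (connected : Connected X) (d₀ : Fin n) where

    Sheets-joined : Set
    Sheets-joined = Conn (d₀ , f0) (d₀ , fs f0)

    sheets-joined⇒connected : Sheets-joined → ∀ x y → Conn x y
    sheets-joined⇒connected joined x y = conn-trans (conn-sym (from-base x)) (from-base y)
      where
      fiber : ∀ c → Conn (d₀ , f0) (d₀ , c)
      fiber f0           = conn-refl
      fiber (fs f0)      = joined
      fiber (fs (fs f0)) = conn-trans joined (Conn-shift joined)
      fiber (fs (fs (fs ())))
      from-base : ∀ x → Conn (d₀ , f0) x
      from-base (d , c) with c′ , path ← Reach-lift (connected d₀ d) c = conn-trans (fiber c′) path

    sheet-unique : ¬ Sheets-joined → ∀ {d c c′} → Conn (d , c) (d₀ , f0) → Conn (d , c′) (d₀ , f0) → c ≡ c′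
    sheet-unique apart {d} {c} {c′} p p′ with c Fin.≟ c′
    ... | yes c≡c′ = c≡c′
    ... | no  c≢c′ =
      ⊥-elim (apart (conn-trans (conn-sym p) (conn-trans (one-up (rot-other c≢c′)) (Conn-shift p))))
      where
      same-fiber : Conn (d , c) (d , c′)
      same-fiber = conn-trans p (conn-sym p′)
      one-up : c′ ≡ rot c ⊎ c′ ≡ rot (rot c) → Conn (d , c) (d , rot c)
      one-up (inj₁ refl) = same-fiber
      one-up (inj₂ refl) = conn-sym (subst (λ z → Conn (d , rot c) (d , z)) (rot³ c) (Conn-shift same-fiber))

    numbering : ¬ Sheets-joined → CoherentEdgeNumbering X
    numbering apart = ν , ν-α , ν-σ
      where
      sheet : ∀ d → ∃ λ c → Conn (d , c) (d₀ , f0)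
      sheet d = Reach-lift (connected d d₀) f0
      ν : Fin n → Fin 3
      ν d = proj₁ (sheet d)
      ν-α : ∀ d → ν (α d) ≡ ν d
      ν-α d = sheet-unique apart (proj₂ (sheet (α d))) (conn-trans (conn-sym conn-a) (proj₂ (sheet d)))
      ν-σ : ∀ d → ν (σ d) ≡ next3 X (ν d)
      ν-σ d = sheet-unique apart (proj₂ (sheet (σ d))) (conn-trans (conn-sym conn-s) (proj₂ (sheet d)))

    sheets-apart : Planar X → FacesDiv3 X → ¬ Sheets-joined
    sheets-apart planar faces-div3 joined = 6≰2 (+-cancelˡ-≤ (#E X * 3) 6 2 (begin
      #E X * 3 + 6                        ≡⟨ *-distribʳ-+ 3 (#E X) 2 ⟨
      (#E X + 2) * 3                      ≡⟨ cong (_* 3) planar ⟨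
      (#V X + #F X) * 3                   ≡⟨ *-distribʳ-+ 3 (#V X) (#F X) ⟩
      #V X * 3 + #F X * 3                 ≤⟨ +-mono-≤ V.#orbits-≤-#classes F.#orbits-≤-#classes ⟩
      #classes V.label + #classes F.label ≤⟨ euler ⟩
      length edges₃ + 2                   ≡⟨ cong (_+ 2) length-edges₃ ⟩
      #E X * 3 + 2                        ∎))
      where
      open ≤-Reasoning
      6≰2 : ¬ 6 ≤ 2
      6≰2 (s≤s (s≤s ()))
      module V = OrbitLabel σ σ-injective σ-returns
      module F = OrbitLabel φ φ-injective (φ-returns faces-div3)
      open Euler V.label F.label V.label-idempotent F.label-idempotent V.label-lift
                 F.label-lift edges₃ edges₃-cover (sheets-joined⇒connected joined)

dart-or-empty : ∀ m → Fin m ⊎ ¬ Fin m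
dart-or-empty zero    = inj₂ λ ()
dart-or-empty (suc m) = inj₁ f0

proposition2p9 : (X : CubicMap) → Connected X → Simple X → Planar X → FacesDiv3 X
                   → CoherentEdgeNumbering X
proposition2p9 X connected _ planar faces-div3 with dart-or-empty (CubicMap.n X)
... | inj₁ d₀      = numbering X connected d₀ (sheets-apart X connected d₀ planar faces-div3)
... | inj₂ no-dart = (λ d → ⊥-elim (no-dart d)) , (λ d → ⊥-elim (no-dart d)) , (λ d → ⊥-elim (no-dart d))
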